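{- For every integer $k\geqslant 1$ there exists a word $W$ over a $3$-letter alphabet with $r(W)\geqslant k$.
   Context: A square is a finite non-empty word of the form $XX$ with $X$ non-empty; a word is square-free if it contains no square as a factor. If $W=UXXV$ with $X$ non-empty, replacing $W$ by $UXV$ is a square reduction. A reduct of $W$ is any square-free word obtainable from $W$ by a finite sequence of square reductions, and $r(W)$ is the number of distinct reducts of $W$. -}

module Defs where

open import Data.Nat using (ℕ)
open import Data.List using (List; []; _∷_; _++_; length)
open import Data.List.Relation.Unary.All using (All)
open import Data.List.Relation.Unary.Unique.Propositional using (Unique)
open import Data.Fin using (Fin)
open import Data.Product using (Σ; _×_; ∃; ∃-syntax)
open import Relation.Binary.PropositionalEquality using (_≡_)
open import Relation.Binary.Construct.Closure.ReflexiveTransitive using (Star)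
open import Relation.Nullary using (¬_)

Word : Set → Set
Word A = List A

NonEmpty : {A : Set} → Word A → Set
NonEmpty w = ¬ (w ≡ [])

Factor : {A : Set} → Word A → Word A → Set
Factor {A} w v = ∃[ u ] ∃[ t ] (v ≡ u ++ (w ++ t))

IsSquare : {A : Set} → Word A → Set
IsSquare {A} w = ∃[ x ] (NonEmpty x × w ≡ x ++ x)

SquareFree : {A : Set} → Word A → Set
SquareFree {A} w = ∀ (s : Word A) → IsSquare s → ¬ Factor s w

data SqRed {A : Set} : Word A → Word A → Set where
  sqred : (u x v : Word A) → NonEmpty x →
          SqRed (u ++ (x ++ (x ++ v))) (u ++ (x ++ v))

SqRed* : {A : Set} → Word A → Word A → Set
SqRed* = Star SqRed

IsReduct : {A : Set} → Word A → Word A → Set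
IsReduct w w' = SqRed* w w' × SquareFree w'

-- r(W) ≥ k : W has at least k pairwise distinct reducts.
AtLeastReducts : {A : Set} → ℕ → Word A → Set
AtLeastReducts {A} k w =
  ∃[ rs ] (length rs ≡ k × Unique rs × All (IsReduct w) rs)

-- Thue's ternary word vtm n = 1 + t (n + 1) − t n, with t the Thue–Morse sequence, is square-free
-- because t is overlap-free. Its prefixes T j, which stop three letters into the block of the j-th
-- zero of t, satisfy T (j + 1) = T j · g j · T 0 with each gap g j one of three short words. A fixed
-- word D reduces to T 0 and contains every gap, D = Q j · g j · S j. Then W 0 = D and
-- W (j + 1) = D · Q j · g j · W j · g j · W j reduce both to W j (erase the square (g j · W j)², then
-- W j, which starts with D, absorbs the prefix) and to T j · g j · T 0 = T (j + 1). So W j has the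
-- j + 1 distinct square-free reducts T 0, …, T j.
module Submission where

open import Defs
open import Data.Bool using (Bool; true; false; not; _xor_; if_then_else_)
open import Data.Bool.Properties
  using (not-involutive; not-injective; not-¬; not-distribˡ-xor; xor-same; xor-assoc; xor-identityʳ; true-xor; xor-comm)
open import Data.Empty using (⊥; ⊥-elim)
open import Data.Fin using (Fin; #_)
open import Data.List using ([]; _∷_; _++_; length; applyUpTo; take; drop)
open import Data.List.Properties
  using (++-assoc; ++-identityʳ; ++-conicalˡ; ++-conicalʳ; length-++; length-applyUpTo; ∷-injective; ∷-injectiveˡ; ∷-injectiveʳ)
open import Data.List.Relation.Unary.All.Properties using (applyUpTo⁺₁)
import Data.List.Relation.Unary.Unique.Propositional.Properties as Unique
open import Data.Nat using (ℕ; zero; suc; _+_; _∸_; _≤_; _<_; _≥_; z≤n; s≤s; z<s; ⌊_/2⌋)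
open import Data.Nat.Induction using (<-rec)
open import Data.Nat.Properties
open import Data.Product using (_×_; _,_; proj₁; proj₂; ∃-syntax)
open import Data.Sum using (inj₁; inj₂)
open import Function using (id; _∘_; _∘′_)
open import Relation.Binary.Construct.Closure.ReflexiveTransitive using (ε; _◅_; _◅◅_; gmap)
open import Relation.Binary.Construct.Closure.ReflexiveTransitive.Properties using (module StarReasoning)
open import Relation.Binary.PropositionalEquality
open import Relation.Nullary using (¬_)

-- Square reductions

module _ {A : Set} where

  _IsPrefixOf_ : Word A → Word A → Set
  x IsPrefixOf y = ∃[ z ] y ≡ x ++ z

  IsPrefixOf-++ʳ : ∀ {x y} w → x IsPrefixOf y → x IsPrefixOf (y ++ w)
  IsPrefixOf-++ʳ {x} w (z , refl) = z ++ w , ++-assoc x z w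

  IsPrefixOf-trans : ∀ {x y w} → x IsPrefixOf y → y IsPrefixOf w → x IsPrefixOf w
  IsPrefixOf-trans {x} (z , refl) (z′ , refl) = z ++ z′ , ++-assoc x z z′

  factor-IsPrefixOf : ∀ {x y} → (f : Factor x y) → (proj₁ f ++ x) IsPrefixOf y
  factor-IsPrefixOf {x} (u , z , refl) = z , sym (++-assoc u x z)

  SqRed-++ˡ : ∀ p {x y : Word A} → SqRed x y → SqRed (p ++ x) (p ++ y)
  SqRed-++ˡ p (sqred u x v ne) =
    subst₂ SqRed (++-assoc p u (x ++ (x ++ v))) (++-assoc p u (x ++ v)) (sqred (p ++ u) x v ne)

  SqRed-++ʳ : ∀ s {x y : Word A} → SqRed x y → SqRed (x ++ s) (y ++ s)
  SqRed-++ʳ s (sqred u x v ne) = subst₂ SqRed (sym before) (sym after) (sqred u x (v ++ s) ne)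
    where
    before : (u ++ (x ++ (x ++ v))) ++ s ≡ u ++ (x ++ (x ++ (v ++ s)))
    before = trans (++-assoc u _ s)
                   (cong (u ++_) (trans (++-assoc x _ s) (cong (x ++_) (++-assoc x v s))))
    after : (u ++ (x ++ v)) ++ s ≡ u ++ (x ++ (v ++ s))
    after = trans (++-assoc u _ s) (cong (u ++_) (++-assoc x v s))

  SqRed*-++ˡ : ∀ p {x y : Word A} → SqRed* x y → SqRed* (p ++ x) (p ++ y)
  SqRed*-++ˡ p = gmap (p ++_) (SqRed-++ˡ p)

  SqRed*-++ʳ : ∀ s {x y : Word A} → SqRed* x y → SqRed* (x ++ s) (y ++ s)
  SqRed*-++ʳ s = gmap (_++ s) (SqRed-++ʳ s)

  squareAt : ∀ i n (w : Word A) → NonEmpty (take n (drop i w)) →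
             w ≡ take i w ++ (take n (drop i w) ++ (take n (drop i w) ++ drop (i + n + n) w)) →
             SqRed w (take i w ++ (take n (drop i w) ++ drop (i + n + n) w))
  squareAt i n w ne eq = subst (λ v → SqRed v (u ++ (x ++ v′))) (sym eq) (sqred u x v′ ne)
    where
    u x v′ : Word A
    u  = take i w
    x  = take n (drop i w)
    v′ = drop (i + n + n) w

  absorb : ∀ {x y : Word A} → NonEmpty x → x IsPrefixOf y → SqRed* (x ++ y) y
  absorb {x} ne (z , refl) = sqred [] x z ne ◅ ε

  SqRed-repeat : ∀ u {x : Word A} y → NonEmpty x → SqRed (u ++ (x ++ (y ++ (x ++ y)))) (u ++ (x ++ y))
  SqRed-repeat u {x} y ne =
    subst₂ SqRed (cong (u ++_) doubled) (cong (u ++_) (++-identityʳ (x ++ y))) (sqred u (x ++ y) [] (ne ∘ ++-conicalˡ x y))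
    where
    doubled : (x ++ y) ++ ((x ++ y) ++ []) ≡ x ++ (y ++ (x ++ y))
    doubled = trans (cong ((x ++ y) ++_) (++-identityʳ (x ++ y))) (++-assoc x y (x ++ y))

  factor-nonEmpty : ∀ {x y : Word A} → Factor x y → NonEmpty x → NonEmpty y
  factor-nonEmpty {x} (u , z , refl) ne = ne ∘ ++-conicalˡ x z ∘ ++-conicalʳ u (x ++ z)

  nonEmpty⇒length>0 : ∀ {x : Word A} → NonEmpty x → 0 < length x
  nonEmpty⇒length>0 {[]} ne = ⊥-elim (ne refl)
  nonEmpty⇒length>0 {_ ∷ _} ne = s≤s z≤n

-- A word with many reducts

module ManyReducts {A : Set} (D : Word A) (T g : ℕ → Word A)
  (D↠T₀ : SqRed* D (T 0))
  (T-suc : ∀ j → T (suc j) ≡ T j ++ (g j ++ T 0))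
  (g-nonEmpty : ∀ j → NonEmpty (g j))
  (g-factor : ∀ j → Factor (g j) D)
  (T-squareFree : ∀ j → SquareFree (T j))
  where

  open StarReasoning (SqRed {A})

  Q : ℕ → Word A
  Q j = proj₁ (g-factor j)

  W : ℕ → Word A
  W zero    = D
  W (suc j) = D ++ (Q j ++ (g j ++ (W j ++ (g j ++ W j))))

  D-IsPrefixOf-W : ∀ i → D IsPrefixOf W i
  D-IsPrefixOf-W zero    = [] , sym (++-identityʳ D)
  D-IsPrefixOf-W (suc i) = _ , refl

  Qg-nonEmpty : ∀ j → NonEmpty (Q j ++ g j)
  Qg-nonEmpty j = g-nonEmpty j ∘ ++-conicalʳ (Q j) (g j)

  D-nonEmpty : NonEmpty D
  D-nonEmpty = factor-nonEmpty (g-factor 0) (g-nonEmpty 0)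

  strip-head : ∀ j {y} → D IsPrefixOf y → SqRed* (D ++ (Q j ++ (g j ++ y))) y
  strip-head j {y} D≼y = begin
    D ++ (Q j ++ (g j ++ y))   ≡⟨ cong (D ++_) (sym (++-assoc (Q j) (g j) y)) ⟩
    D ++ ((Q j ++ g j) ++ y)   ⟶*⟨ SqRed*-++ˡ D (absorb (Qg-nonEmpty j) Qg≼y) ⟩
    D ++ y                     ⟶*⟨ absorb D-nonEmpty D≼y ⟩
    y                          ∎
    where
    Qg≼y : (Q j ++ g j) IsPrefixOf y
    Qg≼y = IsPrefixOf-trans (factor-IsPrefixOf (g-factor j)) D≼y

  W-suc↠W : ∀ j → SqRed* (W (suc j)) (W j)
  W-suc↠W j = begin
    D ++ (Q j ++ (g j ++ (W j ++ (g j ++ W j))))   ⟶⟨ SqRed-++ˡ D (SqRed-repeat (Q j) (W j) (g-nonEmpty j)) ⟩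
    D ++ (Q j ++ (g j ++ W j))                     ⟶*⟨ strip-head j (D-IsPrefixOf-W j) ⟩
    W j                                             ∎

  W↠W : ∀ {m j} → m ≤ j → SqRed* (W j) (W m)
  W↠W {j = zero}  z≤n = ε
  W↠W {j = suc j} m≤1+j with m≤n⇒m<n∨m≡n m≤1+j
  ... | inj₁ (s≤s m≤j) = W-suc↠W j ◅◅ W↠W m≤j
  ... | inj₂ refl      = ε

  W↠T : ∀ j → SqRed* (W j) (T j)
  W↠T zero    = D↠T₀
  W↠T (suc j) = begin
    D ++ (Q j ++ (g j ++ (W j ++ (g j ++ W j))))   ⟶*⟨ strip-head j (IsPrefixOf-++ʳ (g j ++ W j) (D-IsPrefixOf-W j)) ⟩
    W j ++ (g j ++ W j)                             ⟶*⟨ SqRed*-++ʳ (g j ++ W j) (W↠T j) ⟩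
    T j ++ (g j ++ W j)                             ⟶*⟨ SqRed*-++ˡ (T j) (SqRed*-++ˡ (g j) W↠T₀) ⟩
    T j ++ (g j ++ T 0)                             ≡⟨ sym (T-suc j) ⟩
    T (suc j)                                       ∎
    where
    W↠T₀ : SqRed* (W j) (T 0)
    W↠T₀ = W↠W {j = j} z≤n ◅◅ D↠T₀

  length-T-suc : ∀ j → length (T j) < length (T (suc j))
  length-T-suc j rewrite T-suc j | length-++ (T j) {g j ++ T 0} =
    m<m+n (length (T j)) (nonEmpty⇒length>0 (g-nonEmpty j ∘ ++-conicalˡ (g j) (T 0)))

  length-T-mono : ∀ {i j} → i < j → length (T i) < length (T j)
  length-T-mono {i} {suc j} (s≤s i≤j) with m≤n⇒m<n∨m≡n i≤j
  ... | inj₁ i<j = <-trans (length-T-mono i<j) (length-T-suc j)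
  ... | inj₂ refl = length-T-suc j

  W-hasReducts : ∀ j → AtLeastReducts (suc j) (W j)
  W-hasReducts j =
    applyUpTo T (suc j) ,
    length-applyUpTo T (suc j) ,
    Unique.applyUpTo⁺₁ T (suc j) (λ i<i′ _ Ti≡Ti′ → <-irrefl (cong length Ti≡Ti′) (length-T-mono i<i′)) ,
    applyUpTo⁺₁ T (suc j) (λ { (s≤s m≤j) → W↠W m≤j ◅◅ W↠T _ , T-squareFree _ })

-- Square-free factors of infinite words

SquareFreeSequence : {A : Set} → (ℕ → A) → Set
SquareFreeSequence w = ∀ i p → 0 < p → ¬ (∀ j → j < p → w (i + j) ≡ w (i + p + j))

module _ {A : Set} (w : ℕ → A) where

  segment : ℕ → ℕ → Word A
  segment a zero    = []
  segment a (suc n) = w a ∷ segment (suc a) n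

  segment-++ : ∀ a m n → segment a (m + n) ≡ segment a m ++ segment (a + m) n
  segment-++ a zero    n = cong (λ b → segment b n) (sym (+-identityʳ a))
  segment-++ a (suc m) n = cong (w a ∷_) (trans (segment-++ (suc a) m n)
                                                 (cong (λ b → segment (suc a) m ++ segment b n) (sym (+-suc a m))))

  segment-split : ∀ a n (u v : Word A) → segment a n ≡ u ++ v →
                  u ≡ segment a (length u) × v ≡ segment (a + length u) (n ∸ length u)
  segment-split a n       []      v eq = refl , trans (sym eq) (cong (λ b → segment b n) (sym (+-identityʳ a)))
  segment-split a (suc n) (x ∷ u) v eq with ∷-injective eq
  ... | refl , eq′ with segment-split (suc a) n u v eq′
  ...   | u≡ , v≡ =
    cong (w a ∷_) u≡ , trans v≡ (cong (λ b → segment b (n ∸ length u)) (sym (+-suc a (length u))))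

  segment-pointwise : ∀ a b p → segment a p ≡ segment b p → ∀ j → j < p → w (a + j) ≡ w (b + j)
  segment-pointwise a b (suc p) eq zero    _         =
    trans (cong w (+-identityʳ a)) (trans (∷-injectiveˡ eq) (cong w (sym (+-identityʳ b))))
  segment-pointwise a b (suc p) eq (suc j) (s≤s j<p) =
    trans (cong w (+-suc a j))
          (trans (segment-pointwise (suc a) (suc b) p (∷-injectiveʳ eq) j j<p) (cong w (sym (+-suc b j))))

  segment-squareFree : SquareFreeSequence w → ∀ a n → SquareFree (segment a n)
  segment-squareFree sqf a n s (x , ne , refl) (u , t , eq) =
    sqf b p (nonEmpty⇒length>0 ne) (segment-pointwise b (b + p) p (trans (sym first) second))
    where
    p b : ℕ
    p = length x
    b = a + length u
    xxt : segment b (n ∸ length u) ≡ x ++ (x ++ t)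
    xxt = sym (trans (sym (++-assoc x x t)) (proj₂ (segment-split a n u _ eq)))
    first : x ≡ segment b p
    first = proj₁ (segment-split b _ x (x ++ t) xxt)
    second : x ≡ segment (b + p) p
    second = proj₁ (segment-split (b + p) _ x t (sym (proj₂ (segment-split b _ x (x ++ t) xxt))))

-- Overlap-freeness of the Thue–Morse sequence

double : ℕ → ℕ
double zero    = zero
double (suc n) = suc (suc (double n))

data Parity : ℕ → Set where
  even : ∀ m → Parity (double m)
  odd  : ∀ m → Parity (suc (double m))

parity : ∀ n → Parity n
parity zero = even zero
parity (suc n) with parity n
... | even m = odd m
... | odd m  = even (suc m)

oddᵇ : ℕ → Bool
oddᵇ zero    = false
oddᵇ (suc n) = not (oddᵇ n)

double-+ : ∀ m n → double (m + n) ≡ double m + double n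
double-+ zero    n = refl
double-+ (suc m) n = cong (suc ∘′ suc) (double-+ m n)

double-mono-≤ : ∀ {m n} → m ≤ n → double m ≤ double n
double-mono-≤ z≤n       = z≤n
double-mono-≤ (s≤s m≤n) = s≤s (s≤s (double-mono-≤ m≤n))

n≤double : ∀ n → n ≤ double n
n≤double zero    = z≤n
n≤double (suc n) = s≤s (m≤n⇒m≤1+n (n≤double n))

oddᵇ-double : ∀ m → oddᵇ (double m) ≡ false
oddᵇ-double zero    = refl
oddᵇ-double (suc m) = trans (not-involutive _) (oddᵇ-double m)

⌊double/2⌋ : ∀ m → ⌊ double m /2⌋ ≡ m
⌊double/2⌋ zero    = refl
⌊double/2⌋ (suc m) = cong suc (⌊double/2⌋ m)

⌊suc-double/2⌋ : ∀ m → ⌊ suc (double m) /2⌋ ≡ m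
⌊suc-double/2⌋ zero    = refl
⌊suc-double/2⌋ (suc m) = cong suc (⌊suc-double/2⌋ m)

-- The first argument is fuel; it suffices once it is at least n.
thueMorse-fuel : ℕ → ℕ → Bool
thueMorse-fuel zero    n = false
thueMorse-fuel (suc f) n = oddᵇ n xor thueMorse-fuel f ⌊ n /2⌋

tm : ℕ → Bool
tm n = thueMorse-fuel n n

thueMorse-fuel-0 : ∀ f → thueMorse-fuel f 0 ≡ false
thueMorse-fuel-0 zero    = refl
thueMorse-fuel-0 (suc f) = thueMorse-fuel-0 f

thueMorse-fuel-irrelevant : ∀ {f f' n} → n ≤ f → n ≤ f' → thueMorse-fuel f n ≡ thueMorse-fuel f' n
thueMorse-fuel-irrelevant {zero}  {f'}     z≤n _   = sym (thueMorse-fuel-0 f')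
thueMorse-fuel-irrelevant {suc f} {zero}   _   z≤n = thueMorse-fuel-0 (suc f)
thueMorse-fuel-irrelevant {suc f} {suc f'} {n} n≤1+f n≤1+f' =
  cong (oddᵇ n xor_) (thueMorse-fuel-irrelevant (half≤ n≤1+f) (half≤ n≤1+f'))
  where
  half≤ : ∀ {k} → n ≤ suc k → ⌊ n /2⌋ ≤ k
  half≤ {k} n≤1+k = ≤-trans (⌊n/2⌋-mono n≤1+k) (≤-pred (⌊n/2⌋<n k))

tm-unfold : ∀ n → tm n ≡ oddᵇ n xor tm ⌊ n /2⌋
tm-unfold zero    = refl
tm-unfold (suc n) = cong (oddᵇ (suc n) xor_) (thueMorse-fuel-irrelevant (≤-pred (⌊n/2⌋<n n)) ≤-refl)

tm-double : ∀ m → tm (double m) ≡ tm m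
tm-double m rewrite tm-unfold (double m) | oddᵇ-double m | ⌊double/2⌋ m = refl

tm-suc-double : ∀ m → tm (suc (double m)) ≡ not (tm m)
tm-suc-double m rewrite tm-unfold (suc (double m)) | oddᵇ-double m | ⌊suc-double/2⌋ m = refl

Alternates : ℕ → Set
Alternates n = tm (suc n) ≡ not (tm n)

alternates-double : ∀ m → Alternates (double m)
alternates-double m = trans (tm-suc-double m) (cong not (sym (tm-double m)))

alternating-run : ∀ i n → (∀ j → j < n → Alternates (i + j)) → tm (i + n) ≡ oddᵇ n xor tm i
alternating-run i zero    _    = cong tm (+-identityʳ i)
alternating-run i (suc n) alts = begin
  tm (i + suc n)          ≡⟨ cong tm (+-suc i n) ⟩
  tm (suc (i + n))        ≡⟨ alts n ≤-refl ⟩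
  not (tm (i + n))        ≡⟨ cong not (alternating-run i n (λ j j<n → alts j (m≤n⇒m≤1+n j<n))) ⟩
  not (oddᵇ n xor tm i)   ≡⟨ not-distribˡ-xor (oddᵇ n) (tm i) ⟩
  oddᵇ (suc n) xor tm i   ∎
  where open ≡-Reasoning

-- Overlap i p: an overlap a x a x a with |a x| = p starts at position i.
Overlap : ℕ → ℕ → Set
Overlap i p = ∀ j → j ≤ p → tm (i + j) ≡ tm (i + p + j)

overlap-subsample : ∀ {i h p} (f : Bool → Bool) → (∀ {a b} → f a ≡ f b → a ≡ b) →
                    (∀ j → tm (i + double j) ≡ f (tm (h + j))) → Overlap i (double p) → Overlap h p
overlap-subsample {i} {h} {p} f f-injective sample ov j j≤p = f-injective (begin
  f (tm (h + j))                 ≡⟨ sym (sample j) ⟩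
  tm (i + double j)              ≡⟨ ov (double j) (double-mono-≤ j≤p) ⟩
  tm (i + double p + double j)   ≡⟨ cong tm (trans (+-assoc i _ _) (cong (i +_) (sym (double-+ p j)))) ⟩
  tm (i + double (p + j))        ≡⟨ sample (p + j) ⟩
  f (tm (h + (p + j)))           ≡⟨ cong (f ∘ tm) (sym (+-assoc h p j)) ⟩
  f (tm (h + p + j))             ∎)
  where open ≡-Reasoning

overlap-halve : ∀ i p → Overlap i (double p) → ∃[ h ] Overlap h p
overlap-halve i p ov with parity i
... | even h = h , overlap-subsample {i} {h} {p} id id
                     (λ j → trans (cong tm (sym (double-+ h j))) (tm-double (h + j))) ov
... | odd h  = h , overlap-subsample {i} {h} {p} not not-injective
                     (λ j → trans (cong (tm ∘ suc) (sym (double-+ h j))) (tm-suc-double (h + j))) ov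

overlap-transfer : ∀ {i p j} → Overlap i p → j < p → Alternates (i + p + j) → Alternates (i + j)
overlap-transfer {i} {p} {j} ov j<p alt = begin
  tm (suc (i + j))       ≡⟨ cong tm (sym (+-suc i j)) ⟩
  tm (i + suc j)         ≡⟨ ov (suc j) j<p ⟩
  tm (i + p + suc j)     ≡⟨ cong tm (+-suc (i + p) j) ⟩
  tm (suc (i + p + j))   ≡⟨ alt ⟩
  not (tm (i + p + j))   ≡⟨ cong not (sym (ov j (<⇒≤ j<p))) ⟩
  not (tm (i + j))       ∎
  where open ≡-Reasoning

-- Inside an overlap of odd period every position alternates: i + j or its partner i + p + j is even.
overlap-alternates : ∀ i q → Overlap i (suc (double q)) → ∀ j → j < suc (double q) → Alternates (i + j)
overlap-alternates i q ov j j<p with i + j in i+j≡n | parity (i + j)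
... | _ | even m = alternates-double m
... | _ | odd m  = subst Alternates i+j≡n (overlap-transfer {i} {suc (double q)} {j} ov j<p partner-alternates)
  where
  partner-even : i + suc (double q) + j ≡ double (suc (m + q))
  partner-even = begin
    i + suc (double q) + j            ≡⟨ +-assoc i _ j ⟩
    i + (suc (double q) + j)          ≡⟨ cong (i +_) (+-comm (suc (double q)) j) ⟩
    i + (j + suc (double q))          ≡⟨ sym (+-assoc i j _) ⟩
    i + j + suc (double q)            ≡⟨ cong (_+ suc (double q)) i+j≡n ⟩
    suc (double m) + suc (double q)   ≡⟨ cong suc (+-suc (double m) (double q)) ⟩
    suc (suc (double m + double q))   ≡⟨ cong (suc ∘′ suc) (sym (double-+ m q)) ⟩
    double (suc (m + q))              ∎
    where open ≡-Reasoning
  partner-alternates : Alternates (i + suc (double q) + j)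
  partner-alternates = subst Alternates (sym partner-even) (alternates-double (suc (m + q)))

no-odd-overlap : ∀ i q → ¬ Overlap i (suc (double q))
no-odd-overlap i q ov = not-¬ (sym (ov 0 z≤n)) (begin
  tm (i + suc (double q) + 0)      ≡⟨ cong tm (+-identityʳ (i + suc (double q))) ⟩
  tm (i + suc (double q))          ≡⟨ alternating-run i _ (overlap-alternates i q ov) ⟩
  oddᵇ (suc (double q)) xor tm i   ≡⟨ cong (_xor tm i) (cong not (oddᵇ-double q)) ⟩
  not (tm i)                       ≡⟨ cong (not ∘ tm) (sym (+-identityʳ i)) ⟩
  not (tm (i + 0))                 ∎)
  where open ≡-Reasoning

tm-overlapFree : ∀ p → 0 < p → ∀ i → ¬ Overlap i p
tm-overlapFree = <-rec _ (λ p shorter → by-parity p shorter (parity p))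
  where
  by-parity : ∀ p → (∀ {p′} → p′ < p → 0 < p′ → ∀ i → ¬ Overlap i p′) → Parity p → 0 < p → ∀ i → ¬ Overlap i p
  by-parity _ _       (even zero)    ()
  by-parity _ shorter (even (suc q)) _ i ov with overlap-halve i (suc q) ov
  ... | h , ov′ = shorter (s≤s (s≤s (n≤double q))) z<s h ov′
  by-parity _ _       (odd q)        _ i = no-odd-overlap i q

-- Thue's ternary word

letter : Bool → Bool → Fin 3
letter false false = # 1
letter false true  = # 2
letter true  false = # 0
letter true  true  = # 1

vtm : ℕ → Fin 3
vtm n = letter (tm n) (tm (suc n))

letter-xor : ∀ a b a′ b′ → letter a b ≡ letter a′ b′ → a xor a′ ≡ b xor b′
letter-xor false false false false _ = refl
letter-xor false false false true  ()
letter-xor false false true  false ()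
letter-xor false false true  true  _ = refl
letter-xor false true  false false ()
letter-xor false true  false true  _ = refl
letter-xor false true  true  false ()
letter-xor false true  true  true  ()
letter-xor true  false false false ()
letter-xor true  false false true  ()
letter-xor true  false true  false _ = refl
letter-xor true  false true  true  ()
letter-xor true  true  false false _ = refl
letter-xor true  true  false true  ()
letter-xor true  true  true  false ()
letter-xor true  true  true  true  _ = refl

letter-not : ∀ a b → letter a b ≡ letter (not a) (not b) → a ≡ b
letter-not false false _ = refl
letter-not false true  ()
letter-not true  false ()
letter-not true  true  _ = refl

xor-cancelˡ : ∀ a b → a xor (a xor b) ≡ b
xor-cancelˡ a b = trans (sym (xor-assoc a a b)) (cong (_xor b) (xor-same a))

-- Equal letters of vtm keep δ constant, so
-- either tm has an overlap (δ ≡ false) or tm is complemented across the square, which forces it to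
-- be constant on [i, i + p] while tm (i + p) ≠ tm i.
module _ (i p : ℕ) (square : ∀ j → j < p → vtm (i + j) ≡ vtm (i + p + j)) where

  δ : ℕ → Bool
  δ j = tm (i + j) xor tm (i + p + j)

  δ-suc : ∀ j → j < p → δ (suc j) ≡ δ j
  δ-suc j j<p = begin
    tm (i + suc j) xor tm (i + p + suc j)       ≡⟨ cong₂ _xor_ (cong tm (+-suc i j)) (cong tm (+-suc (i + p) j)) ⟩
    tm (suc (i + j)) xor tm (suc (i + p + j))   ≡⟨ sym (letter-xor (tm (i + j)) (tm (suc (i + j)))
                                                                   (tm (i + p + j)) (tm (suc (i + p + j))) (square j j<p)) ⟩
    δ j                                         ∎
    where open ≡-Reasoning

  δ-const : ∀ j → j ≤ p → δ j ≡ δ 0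
  δ-const zero    _   = refl
  δ-const (suc j) j<p = trans (δ-suc j j<p) (δ-const j (<⇒≤ j<p))

  partner : ∀ j → j ≤ p → tm (i + p + j) ≡ tm (i + j) xor δ 0
  partner j j≤p = trans (sym (xor-cancelˡ (tm (i + j)) _)) (cong (tm (i + j) xor_) (δ-const j j≤p))

  square⇒overlap : δ 0 ≡ false → Overlap i p
  square⇒overlap δ₀≡false j j≤p =
    sym (trans (partner j j≤p) (trans (cong (tm (i + j) xor_) δ₀≡false) (xor-identityʳ _)))

  square-complemented : δ 0 ≡ true → ⊥
  square-complemented δ₀≡true = not-¬ (trans (cong tm (+-identityʳ (i + p))) (flat p ≤-refl))
                                      (trans (complement 0 z≤n) (cong (not ∘ tm) (+-identityʳ i)))
    where
    complement : ∀ j → j ≤ p → tm (i + p + j) ≡ not (tm (i + j))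
    complement j j≤p =
      trans (partner j j≤p) (trans (cong (tm (i + j) xor_) δ₀≡true) (trans (xor-comm _ true) (true-xor _)))

    complement-suc : ∀ j → j < p → tm (suc (i + p + j)) ≡ not (tm (suc (i + j)))
    complement-suc j j<p =
      trans (cong tm (sym (+-suc (i + p) j))) (trans (complement (suc j) j<p) (cong (not ∘ tm) (+-suc i j)))

    flat : ∀ j → j ≤ p → tm (i + j) ≡ tm i
    flat zero    _   = cong tm (+-identityʳ i)
    flat (suc j) j<p = begin
      tm (i + suc j)     ≡⟨ cong tm (+-suc i j) ⟩
      tm (suc (i + j))   ≡⟨ sym (letter-not (tm (i + j)) (tm (suc (i + j)))
                                  (trans (square j j<p) (cong₂ letter (complement j (<⇒≤ j<p)) (complement-suc j j<p)))) ⟩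
      tm (i + j)         ≡⟨ flat j (<⇒≤ j<p) ⟩
      tm i               ∎
      where open ≡-Reasoning

vtm-squareFree : SquareFreeSequence vtm
vtm-squareFree i p 0<p square with δ i p square 0 in δ₀
... | false = tm-overlapFree p 0<p i (square⇒overlap i p square δ₀)
... | true  = square-complemented i p square δ₀

-- Prefixes of Thue's ternary word

quad : ℕ → ℕ
quad n = double (double n)

tm-quad : ∀ x → tm (quad x) ≡ tm x
tm-quad x = trans (tm-double (double x)) (tm-double x)

tm-quad+1 : ∀ x → tm (suc (quad x)) ≡ not (tm x)
tm-quad+1 x = trans (tm-suc-double (double x)) (cong not (tm-double x))

tm-quad+2 : ∀ x → tm (suc (suc (quad x))) ≡ not (tm x)
tm-quad+2 x = trans (tm-double (suc (double x))) (tm-suc-double x)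

tm-quad+3 : ∀ x → tm (suc (suc (suc (quad x)))) ≡ tm x
tm-quad+3 x = trans (tm-suc-double (suc (double x))) (trans (cong not (tm-suc-double x)) (not-involutive (tm x)))

block : Bool → Bool → Word (Fin 3)
block a b = letter a (not a) ∷ letter (not a) (not a) ∷ letter (not a) a ∷ letter a b ∷ []

blocks : ℕ → ℕ → Word (Fin 3)
blocks x zero    = []
blocks x (suc n) = block (tm x) (tm (suc x)) ++ blocks (suc x) n

segment-quad : ∀ x n → segment vtm (quad x) (quad n) ≡ blocks x n
segment-quad x zero    = refl
segment-quad x (suc n) rewrite tm-quad x | tm-quad+1 x | tm-quad+2 x | tm-quad+3 x | tm-quad (suc x) =
  cong (λ w → block (tm x) (tm (suc x)) ++ w) (segment-quad (suc x) n)

-- The j-th zero of tm: of the two positions 2j and 2j + 1 exactly one carries false.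
zeroTM : ℕ → ℕ
zeroTM j = if tm (double j) then suc (double j) else double j

tm-zeroTM : ∀ j → tm (zeroTM j) ≡ false
tm-zeroTM j with tm (double j) in eq
... | false = eq
... | true  = trans (alternates-double j) (cong not eq)

gap : Bool → Bool → Word (Fin 3)
gap false false = # 2 ∷ # 0 ∷ # 1 ∷ # 2 ∷ # 0 ∷ []
gap false true  = # 2 ∷ # 0 ∷ # 1 ∷ # 2 ∷ # 1 ∷ # 0 ∷ # 1 ∷ # 2 ∷ # 0 ∷ []
gap true  false = # 1 ∷ []
gap true  true  = # 2 ∷ # 0 ∷ # 1 ∷ # 2 ∷ # 0 ∷ []

gapAt : ℕ → Word (Fin 3)
gapAt j = gap (tm (double j)) (tm (double (suc j)))

T : ℕ → Word (Fin 3)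
T zero    = # 2 ∷ # 1 ∷ # 0 ∷ []
T (suc j) = T j ++ (gapAt j ++ T 0)

zeroTM-suc : ∀ j → ∃[ d ] (zeroTM (suc j) ≡ zeroTM j + d × blocks (zeroTM j) d ≡ T 0 ++ gapAt j)
zeroTM-suc j with tm (double j) in a | tm (double (suc j)) in b
... | false | false = 2 , +-comm 2 (double j) , blocks≡
  where
  blocks≡ : blocks (double j) 2 ≡ T 0 ++ gap false false
  blocks≡ rewrite alternates-double j | a | b = refl
... | false | true  = 3 , +-comm 3 (double j) , blocks≡
  where
  blocks≡ : blocks (double j) 3 ≡ T 0 ++ gap false true
  blocks≡ rewrite alternates-double j | alternates-double (suc j) | a | b = refl
... | true  | false = 1 , +-comm 1 (suc (double j)) , blocks≡
  where
  blocks≡ : blocks (suc (double j)) 1 ≡ T 0 ++ gap true false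
  blocks≡ rewrite alternates-double j | a | b = refl
... | true  | true  = 2 , +-comm 2 (suc (double j)) , blocks≡
  where
  blocks≡ : blocks (suc (double j)) 2 ≡ T 0 ++ gap true true
  blocks≡ rewrite alternates-double j | alternates-double (suc j) | a | b = refl

quad-+ : ∀ m n → quad (m + n) ≡ quad m + quad n
quad-+ m n = trans (cong double (double-+ m n)) (double-+ (double m) (double n))

T≡prefix : ∀ j → T j ≡ segment vtm 0 (quad (zeroTM j)) ++ T 0
T≡prefix zero    = refl
T≡prefix (suc j) with zeroTM-suc j
... | d , next≡ , blocks≡ = begin
  T j ++ (g ++ T 0)                              ≡⟨ cong (_++ (g ++ T 0)) (T≡prefix j) ⟩
  (P ++ T 0) ++ (g ++ T 0)                       ≡⟨ ++-assoc P (T 0) (g ++ T 0) ⟩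
  P ++ (T 0 ++ (g ++ T 0))                       ≡⟨ cong (P ++_) (sym (++-assoc (T 0) g (T 0))) ⟩
  P ++ ((T 0 ++ g) ++ T 0)                       ≡⟨ sym (++-assoc P (T 0 ++ g) (T 0)) ⟩
  (P ++ (T 0 ++ g)) ++ T 0                       ≡⟨ cong (λ w → (P ++ w) ++ T 0) (trans (sym blocks≡) (sym (segment-quad e d))) ⟩
  (P ++ segment vtm (quad e) (quad d)) ++ T 0    ≡⟨ cong (_++ T 0) (sym (segment-++ vtm 0 (quad e) (quad d))) ⟩
  segment vtm 0 (quad e + quad d) ++ T 0         ≡⟨ cong (λ n → segment vtm 0 n ++ T 0) (trans (sym (quad-+ e d)) (cong quad (sym next≡))) ⟩
  segment vtm 0 (quad (zeroTM (suc j))) ++ T 0   ∎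
  where
  open ≡-Reasoning
  e : ℕ
  e = zeroTM j
  g : Word (Fin 3)
  g = gapAt j
  P : Word (Fin 3)
  P = segment vtm 0 (quad e)

segment-quad-zero : ∀ e → tm e ≡ false → segment vtm (quad e) 3 ≡ T 0
segment-quad-zero e tm-e rewrite tm-quad e | tm-quad+1 e | tm-quad+2 e | tm-quad+3 e | tm-e = refl

T-squareFree : ∀ j → SquareFree (T j)
T-squareFree j = subst SquareFree (sym T≡) (segment-squareFree vtm vtm-squareFree 0 (quad e + 3))
  where
  e : ℕ
  e = zeroTM j
  T≡ : T j ≡ segment vtm 0 (quad e + 3)
  T≡ = trans (T≡prefix j) (trans (cong (segment vtm 0 (quad e) ++_) (sym (segment-quad-zero e (tm-zeroTM j))))
                                 (sym (segment-++ vtm 0 (quad e) 3)))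

D : Word (Fin 3)
D = # 2 ∷ # 1 ∷ # 0 ∷ # 2 ∷ # 0 ∷ # 1 ∷ # 2 ∷ # 1 ∷ # 0 ∷ # 1 ∷ # 2 ∷ # 0 ∷ # 1 ∷ # 2 ∷ # 0 ∷ # 1 ∷ # 2 ∷
    # 1 ∷ # 0 ∷ # 1 ∷ # 0 ∷ # 1 ∷ # 2 ∷ # 1 ∷ # 2 ∷ # 0 ∷ # 1 ∷ # 0 ∷ # 2 ∷ # 0 ∷ # 2 ∷ # 1 ∷ # 0 ∷ []

D↠T₀ : SqRed* D (T 0)
D↠T₀ =
  squareAt 11 3 _ (λ ()) refl ◅ squareAt 8 3 _ (λ ()) refl ◅ squareAt 6 4 _ (λ ()) refl ◅
  squareAt 7 2 _ (λ ()) refl ◅ squareAt 4 4 _ (λ ()) refl ◅ squareAt 5 2 _ (λ ()) refl ◅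
  squareAt 3 3 _ (λ ()) refl ◅ squareAt 1 4 _ (λ ()) refl ◅ squareAt 2 2 _ (λ ()) refl ◅
  squareAt 0 3 _ (λ ()) refl ◅ ε

gap-factor : ∀ a b → Factor (gap a b) D
gap-factor false false = take 10 D , drop 15 D , refl
gap-factor false true  = take 3 D , drop 12 D , refl
gap-factor true  false = take 1 D , drop 2 D , refl
gap-factor true  true  = take 10 D , drop 15 D , refl

gap-nonEmpty : ∀ a b → NonEmpty (gap a b)
gap-nonEmpty false false ()
gap-nonEmpty false true  ()
gap-nonEmpty true  false ()
gap-nonEmpty true  true  ()

open ManyReducts D T gapAt D↠T₀ (λ _ → refl)
  (λ _ → gap-nonEmpty _ _) (λ _ → gap-factor _ _) T-squareFree
  using (W; W-hasReducts)

theorem2p4 : (k : ℕ) → k ≥ 1 → ∃[ W ] AtLeastReducts {Fin 3} k W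
theorem2p4 (suc k) _ = W k , W-hasReducts k
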